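{- Let $\mathcal{L}\subseteq\mathbf{Z}^n$ be a lattice of dimension $m$ and let $\mathcal{M}(\mathcal{L})$ be the associated matroid. Then the Stanley–Reisner ideal of the matroid complex $\Delta(\mathcal{M}(\mathcal{L}))$ equals the radical of $V_{\mathcal{L}}$.
   Context: $S=k[x_1,\ldots,x_n]$, $x^u=\prod_i x_i^{u_i}$. For $u\in\mathbf{N}^n$ the fiber is $P_u=\mathrm{conv}\{v\in\mathbf{N}^n: u-v\in\mathcal{L}\}$; the vertex ideal $V_{\mathcal{L}}$ is the monomial ideal spanned by monomials $x^v$ with $v$ not a vertex of $P_v$. Let $B\in\mathbf{Z}^{n\times m}$ have columns forming a basis of $\mathcal{L}$, with rows $b_1,\ldots,b_n$. $\mathcal{M}(\mathcal{L})$ is the matroid on $\{1,\ldots,n\}$ whose maximal independent sets are the complements $[n]\setminus\sigma$ of the subsets $\sigma$ of size $m$ with $\{b_i:i\in\sigma\}$ linearly independent. The matroid complex $\Delta(\mathcal{M})$ is the simplicial complex whose faces are the independent sets of $\mathcal{M}$. The Stanley–Reisner ideal of a simplicial complex on $[n]$ is generated by the squarefree monomials $\prod_{i\in F}x_i$ for the (minimal) non-faces $F$. -}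

module Defs where

open import Data.Nat as ℕ using (ℕ; zero; suc)
open import Data.Integer as ℤ using (ℤ)
open import Data.Rational as ℚ using (ℚ; 0ℚ; 1ℚ)
open import Data.Fin using (Fin; zero; suc)
open import Data.Fin.Subset using (Subset; _∈_; _∉_; _⊆_; ∁; ∣_∣)
open import Data.Vec using (tabulate)
open import Data.Bool using (Bool; true; false)
open import Data.Product using (Σ; ∃; _×_; _,_)
open import Relation.Binary.PropositionalEquality using (_≡_)
open import Relation.Nullary using (¬_)
open import Relation.Nullary.Decidable using (does)

Σℤ : ∀ {k} → (Fin k → ℤ) → ℤ
Σℤ {zero} f = ℤ.+ 0
Σℤ {suc k} f = f zero ℤ.+ Σℤ (λ i → f (suc i))

Σℚ : ∀ {k} → (Fin k → ℚ) → ℚ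
Σℚ {zero} f = 0ℚ
Σℚ {suc k} f = f zero ℚ.+ Σℚ (λ i → f (suc i))

ℕ→ℚ : ℕ → ℚ
ℕ→ℚ a = ℤ.+ a ℚ./ 1

ℤ→ℚ : ℤ → ℚ
ℤ→ℚ a = a ℚ./ 1

Exp : ℕ → Set
Exp n = Fin n → ℕ

-- The n×m integer matrix B (entry B i j = j-th coordinate of row b_i).
Mat : ℕ → ℕ → Set
Mat n m = Fin n → Fin m → ℤ

-- columns of B linearly independent over ℚ (so they form a basis of L = B ℤ^m)
ColsIndep : ∀ {n m} → Mat n m → Set
ColsIndep {n} {m} B =
  (z : Fin m → ℚ) → (∀ i → Σℚ (λ j → ℤ→ℚ (B i j) ℚ.* z j) ≡ 0ℚ) → ∀ j → z j ≡ 0ℚ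

InLattice : ∀ {n m} → Mat n m → (Fin n → ℤ) → Set
InLattice {n} {m} B x = ∃ λ (z : Fin m → ℤ) → ∀ i → x i ≡ Σℤ (λ j → B i j ℤ.* z j)

InFiber : ∀ {n m} → Mat n m → Exp n → Exp n → Set
InFiber B u w = InLattice B (λ i → ℤ.+ u i ℤ.- ℤ.+ w i)

InP : ∀ {n m} → Mat n m → Exp n → (Fin n → ℚ) → Set
InP {n} B u x =
  Σ ℕ λ k → Σ (Fin k → Exp n) λ p → Σ (Fin k → ℚ) λ c →
    (∀ l → InFiber B u (p l)) × (∀ l → 0ℚ ℚ.≤ c l) × (Σℚ c ≡ 1ℚ) ×
    (∀ i → x i ≡ Σℚ (λ l → c l ℚ.* ℕ→ℚ (p l i)))

IsVertex : ∀ {n m} → Mat n m → Exp n → Exp n → Set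
IsVertex {n} B u v =
  InP B u vq ×
  ((p q : Fin n → ℚ) (t : ℚ) → InP B u p → InP B u q →
     0ℚ ℚ.< t → t ℚ.< 1ℚ →
     (∀ i → vq i ≡ t ℚ.* p i ℚ.+ (1ℚ ℚ.- t) ℚ.* q i) →
     ∀ i → p i ≡ q i)
  where vq : Fin n → ℚ
        vq i = ℕ→ℚ (v i)

-- pointwise order (divisibility of monomials) and scaling of exponents
_≤ₑ_ : ∀ {n} → Exp n → Exp n → Set
v ≤ₑ w = ∀ i → v i ℕ.≤ w i

_·ₑ_ : ∀ {n} → ℕ → Exp n → Exp n
(k ·ₑ w) i = k ℕ.* w i

-- x^w ∈ V_L : x^w divisible by a generator x^v with v not a vertex of P_v
InV : ∀ {n m} → Mat n m → Exp n → Set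
InV {n} B w = ∃ λ (v : Exp n) → (v ≤ₑ w) × ¬ IsVertex B v v

InRadV : ∀ {n m} → Mat n m → Exp n → Set
InRadV B w = ∃ λ (k : ℕ) → (1 ℕ.≤ k) × InV B (k ·ₑ w)

RowsIndep : ∀ {n m} → Mat n m → Subset n → Set
RowsIndep {n} {m} B σ =
  (c : Fin n → ℚ) → (∀ i → i ∉ σ → c i ≡ 0ℚ) →
  (∀ j → Σℚ (λ i → c i ℚ.* ℤ→ℚ (B i j)) ≡ 0ℚ) → ∀ i → c i ≡ 0ℚ

-- independent sets of M(L): subsets of complements of bases [n]∖σ
Independent : ∀ {n m} → Mat n m → Subset n → Set
Independent {n} {m} B I =
  ∃ λ (σ : Subset n) → (∣ σ ∣ ≡ m) × RowsIndep B σ × (I ⊆ ∁ σ)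

supp : ∀ {n} → Exp n → Subset n
supp w = tabulate λ i → does (1 ℕ.≤? w i)

-- x^w lies in the Stanley–Reisner ideal of Δ(M(L)): some non-face F
-- (a subset that is not independent) has x_F = ∏_{i∈F} x_i dividing x^w
InSR : ∀ {n m} → Mat n m → Exp n → Set
InSR {n} B w = ∃ λ (F : Subset n) → (F ⊆ supp w) × ¬ Independent B F

{-# OPTIONS --safe #-}

-- Let σ index m linearly independent rows of B. A lattice vector vanishing on σ is zero,
-- so if u vanishes on σ then u is the only point of the fibre, and hence of P_u, that
-- vanishes on σ; as P_u lies in the nonnegative orthant, u is then a vertex. So if
-- x^v ∣ x^(k w) is a generator of V_L, then supp v ⊆ supp w is dependent.
-- Conversely, if F ⊆ supp w is dependent, Gaussian elimination on the rows outside F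
-- cannot produce m independent ones, so it yields a nonzero rational z orthogonal to
-- them; clearing denominators gives a nonzero lattice vector ℓ supported in F. For k
-- large, k w + ℓ and k w - ℓ lie in ℕ^n, hence in the fibre of k w, and k w is their
-- midpoint; so it is not a vertex and x^(k w) ∈ V_L.

module Submission where

open import Defs
open import Algebra.Bundles using (Ring)
import Algebra.Properties.Semiring.Sum as SemiringSum
open import Data.Bool.Properties using (T-≡)
open import Data.Empty using (⊥-elim)
open import Data.Fin using (Fin; zero; suc)
import Data.Fin.Properties as FinP
open import Data.Fin.Subset as Subset using (Subset; _∈_; _∉_; _⊆_; ∁; ∣_∣; ⊥; ⁅_⁆; _∪_; inside; outside)
import Data.Fin.Subset.Properties as SubsetP
open import Data.Integer as ℤ using (ℤ; -[1+_]; 0ℤ)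
import Data.Integer.Properties as ℤP
import Data.Integer.Solver as ℤSolver
import Data.List as List
open import Data.List.Extrema.Nat using (max; xs≤max)
open import Data.List.Relation.Unary.All.Properties using (tabulate⁻)
open import Data.Nat as ℕ using (ℕ; zero; suc; z≤n; s≤s)
import Data.Nat.Properties as ℕP
open import Data.Nat.Coprimality as Coprimality using (Coprime)
open import Data.Product using (∃; _×_; _,_)
open import Data.Rational as ℚ using (ℚ; mkℚ; 0ℚ; 1ℚ; ½; _+_; _*_; _-_; -_; _≤_; _<_; 1/_)
import Data.Rational.Properties as ℚP
import Data.Rational.Unnormalised as ℚᵘ
import Data.Rational.Solver as ℚSolver
open import Data.Sum using (_⊎_; inj₁; inj₂)
open import Data.Vec using (_∷_; here; there)
import Data.Vec.Properties as VecP
open import Function using (_∘_)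
open import Function.Bundles using (_⇔_; mk⇔; Equivalence)
open import Relation.Binary.PropositionalEquality
open import Relation.Nullary using (¬_; yes; no; contradiction)
open import Relation.Nullary.Decidable using (decidable-stable; toWitness; isYes≗does; dec-true; toSum; _×-dec_; ¬?)

open ≡-Reasoning
open ℚSolver.+-*-Solver
module ℤ-Solver = ℤSolver.+-*-Solver

private
  coprime-1 : ∀ a → Coprime a 1
  coprime-1 a = Coprimality.sym (Coprimality.1-coprimeTo a)

-- On the normal form a/1 = mkℚ a 0 the operations of ℚ compute, e.g. the
-- product of two such numbers is literally (a * b) / 1.
ℤ→ℚ≡mkℚ : ∀ a → ℤ→ℚ a ≡ mkℚ a 0 (coprime-1 ℤ.∣ a ∣)
ℤ→ℚ≡mkℚ (ℤ.+ n)    = ℚP.normalize-coprime (coprime-1 n)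
ℤ→ℚ≡mkℚ -[1+ n ] = cong -_ (ℚP.normalize-coprime (coprime-1 (suc n)))

ℤ→ℚ-injective : ∀ {a b} → ℤ→ℚ a ≡ ℤ→ℚ b → a ≡ b
ℤ→ℚ-injective {a} {b} eq = cong ℚ.↥_ (trans (sym (ℤ→ℚ≡mkℚ a)) (trans eq (ℤ→ℚ≡mkℚ b)))

ℤ→ℚ-* : ∀ a b → ℤ→ℚ (a ℤ.* b) ≡ ℤ→ℚ a * ℤ→ℚ b
ℤ→ℚ-* a b = sym (cong₂ _*_ (ℤ→ℚ≡mkℚ a) (ℤ→ℚ≡mkℚ b))

ℤ→ℚ-+ : ∀ a b → ℤ→ℚ (a ℤ.+ b) ≡ ℤ→ℚ a + ℤ→ℚ b
ℤ→ℚ-+ a b =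
  trans (cong (ℚ._/ 1) (sym (cong₂ ℤ._+_ (ℤP.*-identityʳ a) (ℤP.*-identityʳ b))))
        (sym (cong₂ _+_ (ℤ→ℚ≡mkℚ a) (ℤ→ℚ≡mkℚ b)))

ℤ→ℚ-Σℤ : ∀ {k} (f : Fin k → ℤ) → ℤ→ℚ (Σℤ f) ≡ Σℚ (ℤ→ℚ ∘ f)
ℤ→ℚ-Σℤ {zero}  f = refl
ℤ→ℚ-Σℤ {suc k} f = trans (ℤ→ℚ-+ (f zero) _) (cong (ℤ→ℚ (f zero) +_) (ℤ→ℚ-Σℤ (f ∘ suc)))

ℕ→ℚ-injective : ∀ {a b} → ℕ→ℚ a ≡ ℕ→ℚ b → a ≡ b
ℕ→ℚ-injective eq = ℤP.+-injective (ℤ→ℚ-injective eq)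

ℕ→ℚ-+ : ∀ a b → ℕ→ℚ (a ℕ.+ b) ≡ ℕ→ℚ a + ℕ→ℚ b
ℕ→ℚ-+ a b = trans (cong ℤ→ℚ (ℤP.pos-+ a b)) (ℤ→ℚ-+ (ℤ.+ a) (ℤ.+ b))

ℕ→ℚ-* : ∀ a b → ℕ→ℚ (a ℕ.* b) ≡ ℕ→ℚ a * ℕ→ℚ b
ℕ→ℚ-* a b = trans (cong ℤ→ℚ (ℤP.pos-* a b)) (ℤ→ℚ-* (ℤ.+ a) (ℤ.+ b))

ℕ→ℚ-nonNeg : ∀ a → 0ℚ ≤ ℕ→ℚ a
ℕ→ℚ-nonNeg a = ℚP.nonNegative⁻¹ _ {{ℚP.normalize-nonNeg a 1}}

ℕ→ℚ-suc≢0 : ∀ d → ℕ→ℚ (suc d) ≢ 0ℚ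
ℕ→ℚ-suc≢0 d eq with ℕ→ℚ-injective {suc d} {0} eq
... | ()

↧*≡↥ : ∀ q → ℤ→ℚ (ℚ.↧ q) * q ≡ ℤ→ℚ (ℚ.↥ q)
↧*≡↥ q@(mkℚ a d _) = begin
  ℤ→ℚ (ℤ.+ suc d) * q                    ≡⟨ cong (_* q) (ℤ→ℚ≡mkℚ (ℤ.+ suc d)) ⟩
  (ℤ.+ suc d ℤ.* a) ℚ./ (1 ℕ.* suc d)    ≡⟨ ℚP./-cong {ℤ.+ suc d ℤ.* a} refl (ℕP.*-identityˡ (suc d)) ⟩
  (ℤ.+ suc d ℤ.* a) ℚ./ suc d            ≡⟨ ℚP.fromℚᵘ-cong {ℚᵘ.mkℚᵘ (ℤ.+ suc d ℤ.* a) d} {ℚᵘ.mkℚᵘ a 0} (ℚᵘ.*≡* cross) ⟩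
  a ℚ./ 1                                ∎
  where
  cross : (ℤ.+ suc d ℤ.* a) ℤ.* ℤ.+ 1 ≡ a ℤ.* ℤ.+ suc d
  cross = trans (ℤP.*-identityʳ _) (ℤP.*-comm (ℤ.+ suc d) a)

clear-denominators : ∀ {m} (z : Fin m → ℚ) →
                     ∃ λ d → ∃ λ (y : Fin m → ℤ) → ∀ j → ℤ→ℚ (y j) ≡ ℕ→ℚ (suc d) * z j
clear-denominators {zero}  z = 0 , (λ ()) , λ ()
clear-denominators {suc m} z with z zero in z₀≡q | clear-denominators (z ∘ suc)
... | q@(mkℚ a k _) | d , y , y≡dz = d ℕ.+ k ℕ.* suc d , y′ , y′≡Dz
  -- the new multiplier suc (d + k * suc d) is, definitionally, suc k * suc d
  where
  y′ : Fin (suc m) → ℤ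
  y′ zero    = ℤ.+ suc d ℤ.* a
  y′ (suc j) = y j ℤ.* ℤ.+ suc k
  D≡kd : ℕ→ℚ (suc k ℕ.* suc d) ≡ ℕ→ℚ (suc k) * ℕ→ℚ (suc d)
  D≡kd = ℕ→ℚ-* (suc k) (suc d)
  y′≡Dz : ∀ j → ℤ→ℚ (y′ j) ≡ ℕ→ℚ (suc k ℕ.* suc d) * z j
  y′≡Dz zero = begin
    ℤ→ℚ (ℤ.+ suc d ℤ.* a)                      ≡⟨ ℤ→ℚ-* (ℤ.+ suc d) a ⟩
    ℕ→ℚ (suc d) * ℤ→ℚ a                        ≡⟨ cong (ℕ→ℚ (suc d) *_) (↧*≡↥ q) ⟨
    ℕ→ℚ (suc d) * (ℕ→ℚ (suc k) * q)            ≡⟨ solve 3 (λ D K x → D :* (K :* x) := (K :* D) :* x)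
                                                         refl (ℕ→ℚ (suc d)) (ℕ→ℚ (suc k)) q ⟩
    (ℕ→ℚ (suc k) * ℕ→ℚ (suc d)) * q            ≡⟨ cong₂ _*_ D≡kd z₀≡q ⟨
    ℕ→ℚ (suc k ℕ.* suc d) * z zero             ∎
  y′≡Dz (suc j) = begin
    ℤ→ℚ (y j ℤ.* ℤ.+ suc k)                    ≡⟨ ℤ→ℚ-* (y j) (ℤ.+ suc k) ⟩
    ℤ→ℚ (y j) * ℕ→ℚ (suc k)                    ≡⟨ cong (_* ℕ→ℚ (suc k)) (y≡dz j) ⟩
    (ℕ→ℚ (suc d) * z (suc j)) * ℕ→ℚ (suc k)    ≡⟨ solve 3 (λ D x K → (D :* x) :* K := (K :* D) :* x)
                                                         refl (ℕ→ℚ (suc d)) (z (suc j)) (ℕ→ℚ (suc k)) ⟩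
    (ℕ→ℚ (suc k) * ℕ→ℚ (suc d)) * z (suc j)    ≡⟨ cong (_* z (suc j)) D≡kd ⟨
    ℕ→ℚ (suc k ℕ.* suc d) * z (suc j)          ∎

module ∑ = SemiringSum (Ring.semiring ℚP.+-*-ring)

Σℚ≡sum : ∀ {k} (f : Fin k → ℚ) → Σℚ f ≡ ∑.sum f
Σℚ≡sum {zero}  f = refl
Σℚ≡sum {suc k} f = cong (f zero +_) (Σℚ≡sum (f ∘ suc))

Σℚ-cong : ∀ {k} {f g : Fin k → ℚ} → (∀ i → f i ≡ g i) → Σℚ f ≡ Σℚ g
Σℚ-cong {f = f} {g} f≗g = begin
  Σℚ f     ≡⟨ Σℚ≡sum f ⟩
  ∑.sum f  ≡⟨ ∑.sum-cong-≗ f≗g ⟩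
  ∑.sum g  ≡⟨ Σℚ≡sum g ⟨
  Σℚ g     ∎

Σℚ-zero : ∀ {k} {f : Fin k → ℚ} → (∀ i → f i ≡ 0ℚ) → Σℚ f ≡ 0ℚ
Σℚ-zero {k} f≗0 = trans (Σℚ-cong f≗0) (trans (Σℚ≡sum {k} (λ _ → 0ℚ)) (∑.sum-replicate-zero k))

Σℚ-+ : ∀ {k} (f g : Fin k → ℚ) → Σℚ (λ i → f i + g i) ≡ Σℚ f + Σℚ g
Σℚ-+ f g = begin
  Σℚ (λ i → f i + g i)     ≡⟨ Σℚ≡sum (λ i → f i + g i) ⟩
  ∑.sum (λ i → f i + g i)  ≡⟨ ∑.∑-distrib-+ f g ⟩
  ∑.sum f + ∑.sum g        ≡⟨ cong₂ _+_ (Σℚ≡sum f) (Σℚ≡sum g) ⟨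
  Σℚ f + Σℚ g              ∎

Σℚ-*ˡ : ∀ {k} a (f : Fin k → ℚ) → Σℚ (λ i → a * f i) ≡ a * Σℚ f
Σℚ-*ˡ a f = begin
  Σℚ (λ i → a * f i)     ≡⟨ Σℚ≡sum (λ i → a * f i) ⟩
  ∑.sum (λ i → a * f i)  ≡⟨ ∑.*-distribˡ-sum a f ⟨
  a * ∑.sum f            ≡⟨ cong (a *_) (Σℚ≡sum f) ⟨
  a * Σℚ f               ∎

Σℚ-*ʳ : ∀ {k} a (f : Fin k → ℚ) → Σℚ (λ i → f i * a) ≡ Σℚ f * a
Σℚ-*ʳ a f = begin
  Σℚ (λ i → f i * a)     ≡⟨ Σℚ≡sum (λ i → f i * a) ⟩
  ∑.sum (λ i → f i * a)  ≡⟨ ∑.*-distribʳ-sum a f ⟨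
  ∑.sum f * a            ≡⟨ cong (_* a) (Σℚ≡sum f) ⟨
  Σℚ f * a               ∎

Σℚ-comm : ∀ {k l} (f : Fin k → Fin l → ℚ) →
          Σℚ (λ i → Σℚ (f i)) ≡ Σℚ (λ j → Σℚ (λ i → f i j))
Σℚ-comm f = begin
  Σℚ (λ i → Σℚ (f i))                     ≡⟨ Σℚ-cong (Σℚ≡sum ∘ f) ⟩
  Σℚ (λ i → ∑.sum (f i))                  ≡⟨ Σℚ≡sum (∑.sum ∘ f) ⟩
  ∑.sum (λ i → ∑.sum (f i))               ≡⟨ ∑.∑-comm f ⟩
  ∑.sum (λ j → ∑.sum (λ i → f i j))       ≡⟨ Σℚ≡sum (λ j → ∑.sum (λ i → f i j)) ⟨
  Σℚ (λ j → ∑.sum (λ i → f i j))          ≡⟨ Σℚ-cong (λ j → Σℚ≡sum (λ i → f i j)) ⟨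
  Σℚ (λ j → Σℚ (λ i → f i j))             ∎

Σℚ-single : ∀ {k} (f : Fin k → ℚ) i₀ → (∀ i → i ≢ i₀ → f i ≡ 0ℚ) → Σℚ f ≡ f i₀
Σℚ-single f zero f≡0 =
  trans (cong (f zero +_) (Σℚ-zero (λ i → f≡0 (suc i) (λ ())))) (ℚP.+-identityʳ _)
Σℚ-single f (suc i₀) f≡0 =
  trans (cong₂ _+_ (f≡0 zero (λ ())) (Σℚ-single (f ∘ suc) i₀ (λ i i≢i₀ → f≡0 (suc i) (i≢i₀ ∘ FinP.suc-injective))))
        (ℚP.+-identityˡ _)

Σℚ-linear : ∀ {k} (f g : Fin k → ℚ) a → Σℚ (λ i → f i - a * g i) ≡ Σℚ f - a * Σℚ g
Σℚ-linear f g a = begin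
  Σℚ (λ i → f i - a * g i)          ≡⟨ Σℚ-cong (λ i → cong (f i +_) (ℚP.neg-distribˡ-* a (g i))) ⟩
  Σℚ (λ i → f i + (- a) * g i)      ≡⟨ Σℚ-+ f _ ⟩
  Σℚ f + Σℚ (λ i → (- a) * g i)     ≡⟨ cong (Σℚ f +_) (trans (Σℚ-*ˡ (- a) g) (sym (ℚP.neg-distribˡ-* a _))) ⟩
  Σℚ f - a * Σℚ g                   ∎

nonNeg*nonNeg : ∀ {a b} → 0ℚ ≤ a → 0ℚ ≤ b → 0ℚ ≤ a * b
nonNeg*nonNeg {a} {b} 0≤a 0≤b =
  ℚP.nonNegative⁻¹ _ {{ℚP.nonNeg*nonNeg⇒nonNeg a {{ℚ.nonNegative 0≤a}} b {{ℚ.nonNegative 0≤b}}}}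

nonNeg+nonNeg≡0⇒≡0 : ∀ {a b} → 0ℚ ≤ a → 0ℚ ≤ b → a + b ≡ 0ℚ → a ≡ 0ℚ
nonNeg+nonNeg≡0⇒≡0 {a} {b} 0≤a 0≤b a+b≡0 = ℚP.≤-antisym a≤0 0≤a
  where
  a≤0 : a ≤ 0ℚ
  a≤0 = ℚP.≤-trans (ℚP.≤-reflexive (sym (ℚP.+-identityʳ a)))
                   (ℚP.≤-trans (ℚP.+-monoʳ-≤ a 0≤b) (ℚP.≤-reflexive a+b≡0))

Σℚ-nonNeg : ∀ {k} (f : Fin k → ℚ) → (∀ i → 0ℚ ≤ f i) → 0ℚ ≤ Σℚ f
Σℚ-nonNeg {zero}  f 0≤f = ℚP.≤-refl
Σℚ-nonNeg {suc k} f 0≤f = ℚP.+-mono-≤ (0≤f zero) (Σℚ-nonNeg (f ∘ suc) (0≤f ∘ suc))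

Σℚ-nonNeg≡0⇒≡0 : ∀ {k} (f : Fin k → ℚ) → (∀ i → 0ℚ ≤ f i) → Σℚ f ≡ 0ℚ → ∀ i → f i ≡ 0ℚ
Σℚ-nonNeg≡0⇒≡0 f 0≤f Σf≡0 zero =
  nonNeg+nonNeg≡0⇒≡0 (0≤f zero) (Σℚ-nonNeg (f ∘ suc) (0≤f ∘ suc)) Σf≡0
Σℚ-nonNeg≡0⇒≡0 f 0≤f Σf≡0 (suc i) =
  Σℚ-nonNeg≡0⇒≡0 (f ∘ suc) (0≤f ∘ suc)
    (nonNeg+nonNeg≡0⇒≡0 (Σℚ-nonNeg (f ∘ suc) (0≤f ∘ suc)) (0≤f zero) (trans (ℚP.+-comm _ (f zero)) Σf≡0)) i

≢0∧*≡0⇒≡0 : ∀ {a b} → a ≢ 0ℚ → a * b ≡ 0ℚ → b ≡ 0ℚ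
≢0∧*≡0⇒≡0 {a} {b} a≢0 ab≡0 = begin
  b                  ≡⟨ ℚP.*-identityˡ b ⟨
  1ℚ * b             ≡⟨ cong (_* b) (ℚP.*-inverseˡ a) ⟨
  (a⁻¹ * a) * b      ≡⟨ ℚP.*-assoc a⁻¹ a b ⟩
  a⁻¹ * (a * b)      ≡⟨ cong (a⁻¹ *_) ab≡0 ⟩
  a⁻¹ * 0ℚ           ≡⟨ ℚP.*-zeroʳ a⁻¹ ⟩
  0ℚ                 ∎
  where
  instance
    a-nonZero : ℚ.NonZero a
    a-nonZero = ℚ.≢-nonZero a≢0
  a⁻¹ : ℚ
  a⁻¹ = 1/ a

x∉p-x : ∀ {n} {x : Fin n} {p : Subset n} → x ∉ p Subset.- x
x∉p-x {x = zero}  {_ ∷ p} ()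
x∉p-x {x = suc x} {_ ∷ p} (there x∈p-x) = x∉p-x x∈p-x

x∈p⇒1+∣p-x∣≡∣p∣ : ∀ {n} {x : Fin n} {p : Subset n} → x ∈ p → suc ∣ p Subset.- x ∣ ≡ ∣ p ∣
x∈p⇒1+∣p-x∣≡∣p∣ {x = zero}  {inside ∷ p}  here        = cong (suc ∘ ∣_∣) (SubsetP.p─⊥≡p p)
x∈p⇒1+∣p-x∣≡∣p∣ {x = suc x} {inside ∷ p}  (there x∈p) = cong suc (x∈p⇒1+∣p-x∣≡∣p∣ x∈p)
x∈p⇒1+∣p-x∣≡∣p∣ {x = suc x} {outside ∷ p} (there x∈p) = x∈p⇒1+∣p-x∣≡∣p∣ x∈p

x∉p⇒∣p∪⁅x⁆∣≡1+∣p∣ : ∀ {n} {x : Fin n} {p : Subset n} → x ∉ p → ∣ p ∪ ⁅ x ⁆ ∣ ≡ suc ∣ p ∣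
x∉p⇒∣p∪⁅x⁆∣≡1+∣p∣ {x = zero}  {outside ∷ p} _   = cong (suc ∘ ∣_∣) (SubsetP.∪-identityʳ p)
x∉p⇒∣p∪⁅x⁆∣≡1+∣p∣ {x = zero}  {inside ∷ p}  x∉p = contradiction here x∉p
x∉p⇒∣p∪⁅x⁆∣≡1+∣p∣ {x = suc x} {outside ∷ p} x∉p = x∉p⇒∣p∪⁅x⁆∣≡1+∣p∣ (x∉p ∘ there)
x∉p⇒∣p∪⁅x⁆∣≡1+∣p∣ {x = suc x} {inside ∷ p}  x∉p = cong suc (x∉p⇒∣p∪⁅x⁆∣≡1+∣p∣ (x∉p ∘ there))

∈supp⇒1≤ : ∀ {n} (w : Exp n) {i} → i ∈ supp w → 1 ℕ.≤ w i
∈supp⇒1≤ w {i} i∈supp = toWitness {a? = 1 ℕ.≤? w i} (Equivalence.from T-≡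
  (trans (isYes≗does (1 ℕ.≤? w i)) (trans (sym (VecP.lookup∘tabulate _ i)) (VecP.[]=⇒lookup i∈supp))))

1≤⇒∈supp : ∀ {n} (w : Exp n) {i} → 1 ℕ.≤ w i → i ∈ supp w
1≤⇒∈supp w {i} 1≤wᵢ =
  VecP.lookup⇒[]= i (supp w) (trans (VecP.lookup∘tabulate _ i) (dec-true (1 ℕ.≤? w i) 1≤wᵢ))

∉supp⇒≡0 : ∀ {n} (w : Exp n) {i} → i ∉ supp w → w i ≡ 0
∉supp⇒≡0 w i∉supp = ℕP.n<1⇒n≡0 (ℕP.≰⇒> (i∉supp ∘ 1≤⇒∈supp w))

-- Linear algebra over ℚ

infix 8 _∙_

_∙_ : ∀ {m} → (Fin m → ℚ) → (Fin m → ℚ) → ℚ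
x ∙ z = Σℚ (λ j → x j * z j)

lincomb : ∀ {n m} → (Fin n → ℚ) → (Fin n → Fin m → ℚ) → Fin m → ℚ
lincomb c r j = Σℚ (λ i → c i * r i j)

IndependentOn : ∀ {n m} → (Fin n → Fin m → ℚ) → Subset n → Set
IndependentOn {n} r σ =
  (c : Fin n → ℚ) → (∀ i → i ∉ σ → c i ≡ 0ℚ) → (∀ j → lincomb c r j ≡ 0ℚ) → ∀ i → c i ≡ 0ℚ

∙-*ʳ : ∀ {m} (x z : Fin m → ℚ) d → x ∙ (λ j → d * z j) ≡ d * (x ∙ z)
∙-*ʳ x z d = trans (Σℚ-cong (λ j → solve 3 (λ a b e → a :* (e :* b) := e :* (a :* b)) refl (x j) (z j) d))
                   (Σℚ-*ˡ d (λ j → x j * z j))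

∙-disjoint-supports : ∀ {n} {σ : Subset n} {c g : Fin n → ℚ} →
                      (∀ i → i ∉ σ → c i ≡ 0ℚ) → (∀ i → i ∈ σ → g i ≡ 0ℚ) → c ∙ g ≡ 0ℚ
∙-disjoint-supports {σ = σ} {c} {g} c|∁σ≡0 g|σ≡0 = Σℚ-zero term≡0
  where
  term≡0 : ∀ i → c i * g i ≡ 0ℚ
  term≡0 i with i SubsetP.∈? σ
  ... | yes i∈σ = trans (cong (c i *_) (g|σ≡0 i i∈σ)) (ℚP.*-zeroʳ (c i))
  ... | no  i∉σ = trans (cong (_* g i) (c|∁σ≡0 i i∉σ)) (ℚP.*-zeroˡ (g i))

lincomb-∙ : ∀ {n m} (c : Fin n → ℚ) (r : Fin n → Fin m → ℚ) z →
            lincomb c r ∙ z ≡ Σℚ (λ i → c i * (r i ∙ z))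
lincomb-∙ c r z = begin
  Σℚ (λ j → lincomb c r j * z j)               ≡⟨ Σℚ-cong (λ j → Σℚ-*ʳ (z j) (λ i → c i * r i j)) ⟨
  Σℚ (λ j → Σℚ (λ i → (c i * r i j) * z j))    ≡⟨ Σℚ-comm (λ j i → (c i * r i j) * z j) ⟩
  Σℚ (λ i → Σℚ (λ j → (c i * r i j) * z j))    ≡⟨ Σℚ-cong (λ i → Σℚ-cong (λ j → ℚP.*-assoc (c i) (r i j) (z j))) ⟩
  Σℚ (λ i → Σℚ (λ j → c i * (r i j * z j)))    ≡⟨ Σℚ-cong (λ i → Σℚ-*ˡ (c i) (λ j → r i j * z j)) ⟩
  Σℚ (λ i → c i * (r i ∙ z))                   ∎

δ : ∀ {n} → Fin n → Fin n → ℚ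
δ i₀ i with i FinP.≟ i₀
... | yes _ = 1ℚ
... | no  _ = 0ℚ

δ-diag : ∀ {n} (i : Fin n) → δ i i ≡ 1ℚ
δ-diag i with i FinP.≟ i
... | yes _   = refl
... | no  i≢i = contradiction refl i≢i

δ-off : ∀ {n} {i₀ i : Fin n} → i ≢ i₀ → δ i₀ i ≡ 0ℚ
δ-off {i₀ = i₀} {i} i≢i₀ with i FinP.≟ i₀
... | yes i≡i₀ = contradiction i≡i₀ i≢i₀
... | no  _    = refl

δ∙ : ∀ {n} (i₀ : Fin n) (f : Fin n → ℚ) → δ i₀ ∙ f ≡ f i₀
δ∙ i₀ f = trans (Σℚ-single (λ i → δ i₀ i * f i) i₀ (λ i i≢i₀ → trans (cong (_* f i) (δ-off i≢i₀)) (ℚP.*-zeroˡ (f i))))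
                (trans (cong (_* f i₀) (δ-diag i₀)) (ℚP.*-identityˡ (f i₀)))

+δ-diag : ∀ {n} (c : Fin n → ℚ) a i₀ → c i₀ + a * δ i₀ i₀ ≡ c i₀ + a
+δ-diag c a i₀ = trans (cong (λ d → c i₀ + a * d) (δ-diag i₀)) (cong (c i₀ +_) (ℚP.*-identityʳ a))

+δ-off : ∀ {n} (c : Fin n → ℚ) a {i₀ i} → i ≢ i₀ → c i + a * δ i₀ i ≡ c i
+δ-off c a {i = i} i≢i₀ =
  trans (cong (λ d → c i + a * d) (δ-off i≢i₀)) (trans (cong (c i +_) (ℚP.*-zeroʳ a)) (ℚP.+-identityʳ (c i)))

lincomb-+δ : ∀ {n m} (c : Fin n → ℚ) a i₀ (r : Fin n → Fin m → ℚ) j →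
             lincomb (λ i → c i + a * δ i₀ i) r j ≡ lincomb c r j + a * r i₀ j
lincomb-+δ c a i₀ r j = begin
  Σℚ (λ i → (c i + a * δ i₀ i) * r i j)            ≡⟨ Σℚ-cong (λ i → distrib (c i) (δ i₀ i) (r i j)) ⟩
  Σℚ (λ i → c i * r i j + a * (δ i₀ i * r i j))    ≡⟨ Σℚ-+ (λ i → c i * r i j) (λ i → a * (δ i₀ i * r i j)) ⟩
  lincomb c r j + Σℚ (λ i → a * (δ i₀ i * r i j))  ≡⟨ cong (lincomb c r j +_) (Σℚ-*ˡ a (λ i → δ i₀ i * r i j)) ⟩
  lincomb c r j + a * (δ i₀ ∙ (λ i → r i j))       ≡⟨ cong (λ s → lincomb c r j + a * s) (δ∙ i₀ (λ i → r i j)) ⟩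
  lincomb c r j + a * r i₀ j                       ∎
  where
  distrib : ∀ x d y → (x + a * d) * y ≡ x * y + a * (d * y)
  distrib x d y = solve 4 (λ x d y a → (x :+ a :* d) :* y := x :* y :+ a :* (d :* y)) refl x d y a

KernelOrBasis : ∀ {n m} → (Fin n → Fin m → ℚ) → Subset n → Set
KernelOrBasis {m = m} r S =
  (∃ λ z → (∃ λ j → z j ≢ 0ℚ) × (∀ i → i ∈ S → r i ∙ z ≡ 0ℚ)) ⊎
  (∃ λ σ → ∣ σ ∣ ≡ m × σ ⊆ S × IndependentOn r σ)

-- One step of Gaussian elimination with pivot entry r i₀ zero.
module Pivot {n m} (r : Fin n → Fin (suc m) → ℚ) (i₀ : Fin n) (pivot≢0 : r i₀ zero ≢ 0ℚ) where

  private
    a : ℚ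
    a = r i₀ zero
    instance
      a-nonZero : ℚ.NonZero a
      a-nonZero = ℚ.≢-nonZero pivot≢0

  κ : Fin n → ℚ
  κ i = r i zero * 1/ a

  reduced : Fin n → Fin m → ℚ
  reduced i j = r i (suc j) - κ i * r i₀ (suc j)

  κ*a : ∀ i → κ i * a ≡ r i zero
  κ*a i = begin
    (r i zero * 1/ a) * a   ≡⟨ ℚP.*-assoc (r i zero) (1/ a) a ⟩
    r i zero * (1/ a * a)   ≡⟨ cong (r i zero *_) (ℚP.*-inverseˡ a) ⟩
    r i zero * 1ℚ           ≡⟨ ℚP.*-identityʳ (r i zero) ⟩
    r i zero                ∎

  reduced-pivot : ∀ j → reduced i₀ j ≡ 0ℚ
  reduced-pivot j = begin
    r i₀ (suc j) - κ i₀ * r i₀ (suc j)  ≡⟨ cong (λ k → r i₀ (suc j) - k * r i₀ (suc j)) (ℚP.*-inverseʳ a) ⟩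
    r i₀ (suc j) - 1ℚ * r i₀ (suc j)    ≡⟨ cong (λ x → r i₀ (suc j) - x) (ℚP.*-identityˡ (r i₀ (suc j))) ⟩
    r i₀ (suc j) - r i₀ (suc j)         ≡⟨ ℚP.+-inverseʳ (r i₀ (suc j)) ⟩
    0ℚ                                  ∎

  lincomb-head : ∀ c → lincomb c r zero ≡ (c ∙ κ) * a
  lincomb-head c = begin
    Σℚ (λ i → c i * r i zero)      ≡⟨ Σℚ-cong (λ i → cong (c i *_) (κ*a i)) ⟨
    Σℚ (λ i → c i * (κ i * a))     ≡⟨ Σℚ-cong (λ i → ℚP.*-assoc (c i) (κ i) a) ⟨
    Σℚ (λ i → (c i * κ i) * a)     ≡⟨ Σℚ-*ʳ a (λ i → c i * κ i) ⟩
    (c ∙ κ) * a                    ∎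

  lincomb-reduced : ∀ c j → lincomb c reduced j ≡ lincomb c r (suc j) - r i₀ (suc j) * (c ∙ κ)
  lincomb-reduced c j = trans (Σℚ-cong (λ i → expand (c i) (r i (suc j)) (κ i) (r i₀ (suc j))))
                              (Σℚ-linear (λ i → c i * r i (suc j)) (λ i → c i * κ i) (r i₀ (suc j)))
    where
    expand : ∀ x y k p → x * (y - k * p) ≡ x * y - p * (x * k)
    expand = solve 4 (λ x y k p → x :* (y :- k :* p) := x :* y :- p :* (x :* k)) refl

  ∙-reduced : ∀ i z → reduced i ∙ z ≡ (r i ∘ suc) ∙ z - κ i * ((r i₀ ∘ suc) ∙ z)
  ∙-reduced i z = trans (Σℚ-cong (λ j → expand (r i (suc j)) (κ i) (r i₀ (suc j)) (z j)))
                        (Σℚ-linear (λ j → r i (suc j) * z j) (λ j → r i₀ (suc j) * z j) (κ i))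
    where
    expand : ∀ y k p x → (y - k * p) * x ≡ y * x - k * (p * x)
    expand = solve 4 (λ y k p x → (y :- k :* p) :* x := y :* x :- k :* (p :* x)) refl

  dependency-reduces : ∀ c → (∀ j → lincomb c r j ≡ 0ℚ) → ∀ j → lincomb c reduced j ≡ 0ℚ
  dependency-reduces c dep j = begin
    lincomb c reduced j                          ≡⟨ lincomb-reduced c j ⟩
    lincomb c r (suc j) - r i₀ (suc j) * (c ∙ κ) ≡⟨ cong₂ (λ x y → x - r i₀ (suc j) * y) (dep (suc j)) c∙κ≡0 ⟩
    0ℚ - r i₀ (suc j) * 0ℚ                       ≡⟨ solve 1 (λ p → con 0ℚ :- p :* con 0ℚ := con 0ℚ) refl (r i₀ (suc j)) ⟩
    0ℚ                                           ∎
    where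
    c∙κ≡0 : c ∙ κ ≡ 0ℚ
    c∙κ≡0 = ≢0∧*≡0⇒≡0 pivot≢0 (trans (ℚP.*-comm a (c ∙ κ)) (trans (sym (lincomb-head c)) (dep zero)))

  dependency-lifts : ∀ c → (∀ j → lincomb c reduced j ≡ 0ℚ) →
                     ∀ j → lincomb (λ i → c i + (- (c ∙ κ)) * δ i₀ i) r j ≡ 0ℚ
  dependency-lifts c dep zero = begin
    lincomb (λ i → c i + (- (c ∙ κ)) * δ i₀ i) r zero  ≡⟨ lincomb-+δ c (- (c ∙ κ)) i₀ r zero ⟩
    lincomb c r zero + (- (c ∙ κ)) * a                 ≡⟨ cong (_+ (- (c ∙ κ)) * a) (lincomb-head c) ⟩
    (c ∙ κ) * a + (- (c ∙ κ)) * a                      ≡⟨ solve 2 (λ μ a → μ :* a :+ (:- μ) :* a := con 0ℚ) refl (c ∙ κ) a ⟩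
    0ℚ                                                 ∎
  dependency-lifts c dep (suc j) = begin
    lincomb (λ i → c i + (- (c ∙ κ)) * δ i₀ i) r (suc j)  ≡⟨ lincomb-+δ c (- (c ∙ κ)) i₀ r (suc j) ⟩
    lincomb c r (suc j) + (- (c ∙ κ)) * r i₀ (suc j)      ≡⟨ solve 3 (λ s μ p → s :+ (:- μ) :* p := s :- p :* μ)
                                                                     refl (lincomb c r (suc j)) (c ∙ κ) (r i₀ (suc j)) ⟩
    lincomb c r (suc j) - r i₀ (suc j) * (c ∙ κ)          ≡⟨ lincomb-reduced c j ⟨
    lincomb c reduced j                                   ≡⟨ dep j ⟩
    0ℚ                                                    ∎

  extend : (Fin m → ℚ) → Fin (suc m) → ℚ
  extend z zero    = - ((r i₀ ∘ suc) ∙ z) * 1/ a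
  extend z (suc j) = z j

  ∙-extend : ∀ i z → r i ∙ extend z ≡ reduced i ∙ z
  ∙-extend i z = begin
    r i zero * (- s * 1/ a) + (r i ∘ suc) ∙ z  ≡⟨ solve 4 (λ x s b u → x :* (:- s :* b) :+ u := u :- (x :* b) :* s)
                                                          refl (r i zero) s (1/ a) ((r i ∘ suc) ∙ z) ⟩
    (r i ∘ suc) ∙ z - κ i * s                  ≡⟨ ∙-reduced i z ⟨
    reduced i ∙ z                              ∎
    where
    s : ℚ
    s = (r i₀ ∘ suc) ∙ z

  independent-reduces : ∀ {σ} → i₀ ∈ σ → IndependentOn r σ → IndependentOn reduced (σ Subset.- i₀)
  independent-reduces {σ} i₀∈σ σ-indep c c|∁σ-i₀≡0 dep i with i FinP.≟ i₀
  ... | yes refl = c|∁σ-i₀≡0 i₀ x∉p-x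
  ... | no  i≢i₀ = trans (sym (+δ-off c (- (c ∙ κ)) i≢i₀)) (lifted≡0 i)
    where
    lifted≡0 : ∀ i → c i + (- (c ∙ κ)) * δ i₀ i ≡ 0ℚ
    lifted≡0 = σ-indep _ lifted|∁σ≡0 (dependency-lifts c dep)
      where
      lifted|∁σ≡0 : ∀ i → i ∉ σ → c i + (- (c ∙ κ)) * δ i₀ i ≡ 0ℚ
      lifted|∁σ≡0 i i∉σ = trans (+δ-off c (- (c ∙ κ)) i≢i₀′) (c|∁σ-i₀≡0 i (i∉σ ∘ SubsetP.p─q⊆p σ ⁅ i₀ ⁆))
        where
        i≢i₀′ : i ≢ i₀
        i≢i₀′ refl = i∉σ i₀∈σ

  independent-extends : ∀ {σ} → i₀ ∉ σ → IndependentOn reduced σ → IndependentOn r (σ ∪ ⁅ i₀ ⁆)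
  independent-extends {σ} i₀∉σ σ-indep c c|∁σ∪i₀≡0 dep = c≡0
    where
    c′ : Fin n → ℚ
    c′ i = c i + (- c i₀) * δ i₀ i
    c′≡0 : ∀ i → c′ i ≡ 0ℚ
    c′≡0 = σ-indep c′ c′|∁σ≡0 λ j → begin
      lincomb c′ reduced j                           ≡⟨ lincomb-+δ c (- c i₀) i₀ reduced j ⟩
      lincomb c reduced j + (- c i₀) * reduced i₀ j  ≡⟨ cong₂ (λ x y → x + (- c i₀) * y)
                                                              (dependency-reduces c dep j) (reduced-pivot j) ⟩
      0ℚ + (- c i₀) * 0ℚ                             ≡⟨ solve 1 (λ x → con 0ℚ :+ x :* con 0ℚ := con 0ℚ) refl (- c i₀) ⟩
      0ℚ                                             ∎
      where
      c′|∁σ≡0 : ∀ i → i ∉ σ → c′ i ≡ 0ℚ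
      c′|∁σ≡0 i i∉σ with toSum (i FinP.≟ i₀)
      ... | inj₁ refl = trans (+δ-diag c (- c i₀) i₀) (ℚP.+-inverseʳ (c i₀))
      ... | inj₂ i≢i₀ = trans (+δ-off c (- c i₀) i≢i₀) (c|∁σ∪i₀≡0 i i∉σ∪i₀)
        where
        i∉σ∪i₀ : i ∉ σ ∪ ⁅ i₀ ⁆
        i∉σ∪i₀ h with SubsetP.x∈p∪q⁻ σ ⁅ i₀ ⁆ h
        ... | inj₁ i∈σ  = i∉σ i∈σ
        ... | inj₂ i∈i₀ = i≢i₀ (SubsetP.x∈⁅y⁆⇒x≡y i₀ i∈i₀)
    c-off≡0 : ∀ i → i ≢ i₀ → c i ≡ 0ℚ
    c-off≡0 i i≢i₀ = trans (sym (+δ-off c (- c i₀) i≢i₀)) (c′≡0 i)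
    c≡0 : ∀ i → c i ≡ 0ℚ
    c≡0 i with i FinP.≟ i₀
    ... | no  i≢i₀ = c-off≡0 i i≢i₀
    ... | yes refl = ≢0∧*≡0⇒≡0 pivot≢0 (begin
      a * c i₀                  ≡⟨ ℚP.*-comm a (c i₀) ⟩
      c i₀ * a                  ≡⟨ Σℚ-single (λ i → c i * r i zero) i₀ off-pivot≡0 ⟨
      lincomb c r zero          ≡⟨ dep zero ⟩
      0ℚ                        ∎)
      where
      off-pivot≡0 : ∀ i → i ≢ i₀ → c i * r i zero ≡ 0ℚ
      off-pivot≡0 i i≢i₀ = trans (cong (_* r i zero) (c-off≡0 i i≢i₀)) (ℚP.*-zeroˡ (r i zero))

  kernel-or-basis-lifts : ∀ {S} → i₀ ∈ S → KernelOrBasis reduced (S Subset.- i₀) → KernelOrBasis r S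
  kernel-or-basis-lifts {S} _ (inj₁ (z , (j , zⱼ≢0) , z⊥S-i₀)) = inj₁ (extend z , (suc j , zⱼ≢0) , extend-z⊥S)
    where
    extend-z⊥S : ∀ i → i ∈ S → r i ∙ extend z ≡ 0ℚ
    extend-z⊥S i i∈S with i FinP.≟ i₀
    ... | yes refl = trans (∙-extend i₀ z) (Σℚ-zero (λ j → trans (cong (_* z j) (reduced-pivot j)) (ℚP.*-zeroˡ (z j))))
    ... | no  i≢i₀ = trans (∙-extend i z) (z⊥S-i₀ i (SubsetP.x∈p∧x≢y⇒x∈p-y i∈S i≢i₀))
  kernel-or-basis-lifts {S} i₀∈S (inj₂ (σ , ∣σ∣≡m , σ⊆S-i₀ , σ-indep)) =
    inj₂ (σ ∪ ⁅ i₀ ⁆ , trans (x∉p⇒∣p∪⁅x⁆∣≡1+∣p∣ i₀∉σ) (cong suc ∣σ∣≡m) , σ∪i₀⊆S , independent-extends i₀∉σ σ-indep)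
    where
    i₀∉σ : i₀ ∉ σ
    i₀∉σ = x∉p-x ∘ σ⊆S-i₀
    σ∪i₀⊆S : σ ∪ ⁅ i₀ ⁆ ⊆ S
    σ∪i₀⊆S h with SubsetP.x∈p∪q⁻ σ ⁅ i₀ ⁆ h
    ... | inj₁ i∈σ  = SubsetP.p─q⊆p S ⁅ i₀ ⁆ (σ⊆S-i₀ i∈σ)
    ... | inj₂ i∈i₀ = subst (_∈ S) (sym (SubsetP.x∈⁅y⁆⇒x≡y i₀ i∈i₀)) i₀∈S

pivot-or-zero-column : ∀ {n m} (r : Fin n → Fin (suc m) → ℚ) (S : Subset n) →
           (∃ λ i → i ∈ S × r i zero ≢ 0ℚ) ⊎ (∀ i → i ∈ S → r i zero ≡ 0ℚ)
pivot-or-zero-column r S with FinP.any? (λ i → (i SubsetP.∈? S) ×-dec ¬? (r i zero ℚP.≟ 0ℚ))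
... | yes pivot = inj₁ pivot
... | no ¬pivot = inj₂ λ i i∈S →
  decidable-stable (r i zero ℚP.≟ 0ℚ) (λ rᵢ₀≢0 → ¬pivot (i , i∈S , rᵢ₀≢0))

kernel-or-basis : ∀ {n} m (r : Fin n → Fin m → ℚ) (S : Subset n) → KernelOrBasis r S
kernel-or-basis {n} zero r S =
  inj₂ (⊥ , SubsetP.∣⊥∣≡0 n , SubsetP.⊥⊆ , λ c c|∁⊥≡0 _ i → c|∁⊥≡0 i SubsetP.∉⊥)
kernel-or-basis (suc m) r S with pivot-or-zero-column r S
... | inj₂ column₀≡0 = inj₁ (δ zero , (zero , δ₀₀≢0) , r∙δ₀≡0)
  where
  δ₀₀≢0 : δ {suc m} zero zero ≢ 0ℚ
  δ₀₀≢0 δ₀₀≡0 = ℚP.1≢0 (trans (sym (δ-diag {suc m} zero)) δ₀₀≡0)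
  r∙δ₀≡0 : ∀ i → i ∈ S → r i ∙ δ zero ≡ 0ℚ
  r∙δ₀≡0 i i∈S = begin
    r i ∙ δ zero                    ≡⟨ Σℚ-cong (λ j → ℚP.*-comm (r i j) (δ zero j)) ⟩
    δ zero ∙ r i                    ≡⟨ δ∙ zero (r i) ⟩
    r i zero                        ≡⟨ column₀≡0 i i∈S ⟩
    0ℚ                              ∎
... | inj₁ (i₀ , i₀∈S , pivot≢0) =
  kernel-or-basis-lifts i₀∈S (kernel-or-basis m reduced (S Subset.- i₀))
  where open Pivot r i₀ pivot≢0

independent⇒∣σ∣≤m : ∀ {n} m (r : Fin n → Fin m → ℚ) σ → IndependentOn r σ → ∣ σ ∣ ℕ.≤ m
independent⇒∣σ∣≤m {n} zero r σ σ-indep with SubsetP.nonempty? σ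
... | yes (i , i∈σ) = contradiction (σ-indep (δ i) δᵢ|∁σ≡0 (λ ()) i) δᵢᵢ≢0
  where
  δᵢᵢ≢0 : δ i i ≢ 0ℚ
  δᵢᵢ≢0 δᵢᵢ≡0 = ℚP.1≢0 (trans (sym (δ-diag i)) δᵢᵢ≡0)
  δᵢ|∁σ≡0 : ∀ i′ → i′ ∉ σ → δ i i′ ≡ 0ℚ
  δᵢ|∁σ≡0 i′ i′∉σ = δ-off (λ i′≡i → i′∉σ (subst (_∈ σ) (sym i′≡i) i∈σ))
... | no σ-empty = ℕP.≤-reflexive (trans (cong ∣_∣ (SubsetP.Empty-unique σ-empty)) (SubsetP.∣⊥∣≡0 n))
independent⇒∣σ∣≤m (suc m) r σ σ-indep with pivot-or-zero-column r σ
... | inj₂ column₀≡0 = ℕP.m≤n⇒m≤1+n (independent⇒∣σ∣≤m m (λ i j → r i (suc j)) σ tail-indep)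
  where
  tail-indep : IndependentOn (λ i j → r i (suc j)) σ
  tail-indep c c|∁σ≡0 dep = σ-indep c c|∁σ≡0 λ
    { zero    → ∙-disjoint-supports c|∁σ≡0 column₀≡0
    ; (suc j) → dep j
    }
... | inj₁ (i₀ , i₀∈σ , pivot≢0) =
  subst (ℕ._≤ suc m) (x∈p⇒1+∣p-x∣≡∣p∣ i₀∈σ)
        (s≤s (independent⇒∣σ∣≤m m reduced (σ Subset.- i₀) (independent-reduces i₀∈σ σ-indep)))
  where open Pivot r i₀ pivot≢0

basis⇒kernel-trivial : ∀ {n m} (r : Fin n → Fin m → ℚ) {σ} → IndependentOn r σ → ∣ σ ∣ ≡ m →
                       ∀ z → (∀ i → i ∈ σ → r i ∙ z ≡ 0ℚ) → ∀ j → z j ≡ 0ℚ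
basis⇒kernel-trivial {n} {m} r {σ} σ-indep ∣σ∣≡m z z⊥σ j₀ =
  decidable-stable (z j₀ ℚP.≟ 0ℚ) λ zⱼ₀≢0 →
    ℕP.<-irrefl ∣σ∣≡m (independent⇒∣σ∣≤m m R (inside ∷ σ) (R-indep zⱼ₀≢0))
  where
  -- adjoining the unit row δ j₀ to the basis would give m + 1 independent rows
  R : Fin (suc n) → Fin m → ℚ
  R zero    = δ j₀
  R (suc i) = r i
  R-indep : z j₀ ≢ 0ℚ → IndependentOn R (inside ∷ σ)
  R-indep zⱼ₀≢0 C C|∁≡0 dep = λ { zero → C₀≡0 ; (suc i) → tail≡0 i }
    where
    tail|∁σ≡0 : ∀ i → i ∉ σ → C (suc i) ≡ 0ℚ
    tail|∁σ≡0 i i∉σ = C|∁≡0 (suc i) (i∉σ ∘ SubsetP.drop-there)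
    C₀≡0 : C zero ≡ 0ℚ
    C₀≡0 = ≢0∧*≡0⇒≡0 zⱼ₀≢0 (begin
      z j₀ * C zero                                      ≡⟨ ℚP.*-comm (z j₀) (C zero) ⟩
      C zero * z j₀                                      ≡⟨ cong (C zero *_) (δ∙ j₀ z) ⟨
      C zero * (δ j₀ ∙ z)                                ≡⟨ ℚP.+-identityʳ _ ⟨
      C zero * (δ j₀ ∙ z) + 0ℚ                           ≡⟨ cong (C zero * (δ j₀ ∙ z) +_) rest≡0 ⟨
      C zero * (δ j₀ ∙ z) + (C ∘ suc) ∙ (λ i → r i ∙ z)  ≡⟨ lincomb-∙ C R z ⟨
      lincomb C R ∙ z                                    ≡⟨ Σℚ-zero (λ j → trans (cong (_* z j) (dep j)) (ℚP.*-zeroˡ (z j))) ⟩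
      0ℚ                                                 ∎)
      where
      rest≡0 : (C ∘ suc) ∙ (λ i → r i ∙ z) ≡ 0ℚ
      rest≡0 = ∙-disjoint-supports tail|∁σ≡0 z⊥σ
    tail≡0 : ∀ i → C (suc i) ≡ 0ℚ
    tail≡0 = σ-indep (C ∘ suc) tail|∁σ≡0 λ j → begin
      lincomb (C ∘ suc) r j                        ≡⟨ ℚP.+-identityˡ _ ⟨
      0ℚ + lincomb (C ∘ suc) r j                   ≡⟨ cong (_+ lincomb (C ∘ suc) r j) (ℚP.*-zeroˡ (δ j₀ j)) ⟨
      0ℚ * δ j₀ j + lincomb (C ∘ suc) r j          ≡⟨ cong (λ c → c * δ j₀ j + lincomb (C ∘ suc) r j) C₀≡0 ⟨
      lincomb C R j                                ≡⟨ dep j ⟩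
      0ℚ                                           ∎

-- Lattices and fibres

-- RowsIndep B σ unfolds to IndependentOn (rowsℚ B) σ, and ColsIndep B to the
-- statement that only z = 0 satisfies rowsℚ B i ∙ z ≡ 0ℚ for all i.
rowsℚ : ∀ {n m} → Mat n m → Fin n → Fin m → ℚ
rowsℚ B i j = ℤ→ℚ (B i j)

ℤ→ℚ-Bz : ∀ {n m} (B : Mat n m) (z : Fin m → ℤ) i →
         ℤ→ℚ (Σℤ (λ j → B i j ℤ.* z j)) ≡ rowsℚ B i ∙ (ℤ→ℚ ∘ z)
ℤ→ℚ-Bz B z i = trans (ℤ→ℚ-Σℤ (λ j → B i j ℤ.* z j)) (Σℚ-cong (λ j → ℤ→ℚ-* (B i j) (z j)))

Σℤ-*0 : ∀ {k} (f : Fin k → ℤ) → Σℤ (λ j → f j ℤ.* 0ℤ) ≡ 0ℤ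
Σℤ-*0 {zero}  f = refl
Σℤ-*0 {suc k} f = cong₂ ℤ._+_ (ℤP.*-zeroʳ (f zero)) (Σℤ-*0 (f ∘ suc))

Σℤ-*-neg : ∀ {k} (f g : Fin k → ℤ) → Σℤ (λ j → f j ℤ.* ℤ.- g j) ≡ ℤ.- Σℤ (λ j → f j ℤ.* g j)
Σℤ-*-neg {zero}  f g = refl
Σℤ-*-neg {suc k} f g = trans
  (cong₂ ℤ._+_ (sym (ℤP.neg-distribʳ-* (f zero) (g zero))) (Σℤ-*-neg (f ∘ suc) (g ∘ suc)))
  (sym (ℤP.neg-distrib-+ (f zero ℤ.* g zero) _))

InLattice-cong : ∀ {n m} (B : Mat n m) {x y} → InLattice B x → (∀ i → x i ≡ y i) → InLattice B y
InLattice-cong B (z , x≡Bz) x≗y = z , λ i → trans (sym (x≗y i)) (x≡Bz i)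

InLattice-neg : ∀ {n m} (B : Mat n m) {x} → InLattice B x → InLattice B (λ i → ℤ.- x i)
InLattice-neg B (z , x≡Bz) =
  (λ j → ℤ.- z j) , λ i → trans (cong ℤ.-_ (x≡Bz i)) (sym (Σℤ-*-neg (B i) z))

InFiber-refl : ∀ {n m} (B : Mat n m) u → InFiber B u u
InFiber-refl B u = (λ _ → 0ℤ) , λ i → trans (ℤP.+-inverseʳ (ℤ.+ u i)) (sym (Σℤ-*0 (B i)))

InP-point : ∀ {n m} (B : Mat n m) {u} p → InFiber B u p → InP B u (ℕ→ℚ ∘ p)
InP-point B p p∈fiber =
  1 , (λ _ → p) , (λ _ → 1ℚ) , (λ _ → p∈fiber) , (λ _ → ℕ→ℚ-nonNeg 1) , ℚP.+-identityʳ 1ℚ ,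
  λ i → sym (trans (ℚP.+-identityʳ _) (ℚP.*-identityˡ _))

InP-nonNeg : ∀ {n m} (B : Mat n m) {u x} → InP B u x → ∀ i → 0ℚ ≤ x i
InP-nonNeg B (_ , p , c , _ , 0≤c , _ , x≡Σcp) i =
  subst (0ℚ ≤_) (sym (x≡Σcp i)) (Σℚ-nonNeg _ (λ l → nonNeg*nonNeg (0≤c l) (ℕ→ℚ-nonNeg (p l i))))

-- Independent supports give vertices

module _ {n m} (B : Mat n m) {σ : Subset n} (∣σ∣≡m : ∣ σ ∣ ≡ m) (σ-indep : RowsIndep B σ) where

  lattice-vanishing-on-basis⇒≡0 : ∀ {x} → InLattice B x → (∀ i → i ∈ σ → x i ≡ 0ℤ) → ∀ i → x i ≡ 0ℤ
  lattice-vanishing-on-basis⇒≡0 {x} (z , x≡Bz) x|σ≡0 i = ℤ→ℚ-injective (begin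
    ℤ→ℚ (x i)                       ≡⟨ cong ℤ→ℚ (x≡Bz i) ⟩
    ℤ→ℚ (Σℤ (λ j → B i j ℤ.* z j))  ≡⟨ ℤ→ℚ-Bz B z i ⟩
    rowsℚ B i ∙ (ℤ→ℚ ∘ z)           ≡⟨ Σℚ-zero (λ j → trans (cong (rowsℚ B i j *_) (z≡0 j)) (ℚP.*-zeroʳ (rowsℚ B i j))) ⟩
    0ℚ                              ∎)
    where
    z≡0 : ∀ j → ℤ→ℚ (z j) ≡ 0ℚ
    z≡0 = basis⇒kernel-trivial (rowsℚ B) σ-indep ∣σ∣≡m (ℤ→ℚ ∘ z) λ i i∈σ →
      trans (sym (ℤ→ℚ-Bz B z i)) (cong ℤ→ℚ (trans (sym (x≡Bz i)) (x|σ≡0 i i∈σ)))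

  fibre-agreeing-on-basis⇒≡ : ∀ {u p} → InFiber B u p → (∀ i → i ∈ σ → p i ≡ u i) → ∀ i → p i ≡ u i
  fibre-agreeing-on-basis⇒≡ {u} {p} p∈fiber p|σ≡u i = ℤP.+-injective (sym (ℤP.i-j≡0⇒i≡j _ _
    (lattice-vanishing-on-basis⇒≡0 p∈fiber (λ i i∈σ → ℤP.i≡j⇒i-j≡0 (cong ℤ.+_ (sym (p|σ≡u i i∈σ)))) i)))

  -- A convex combination vanishing on σ only uses fibre points vanishing on σ,
  -- and by the previous lemma the only such point is u itself.
  InP-vanishing-on-basis⇒≡u : ∀ {u x} → (∀ i → i ∈ σ → u i ≡ 0) → InP B u x →
                              (∀ i → i ∈ σ → x i ≡ 0ℚ) → ∀ i → x i ≡ ℕ→ℚ (u i)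
  InP-vanishing-on-basis⇒≡u {u} {x} u|σ≡0 (_ , p , c , p∈fiber , 0≤c , Σc≡1 , x≡Σcp) x|σ≡0 i = begin
    x i                              ≡⟨ x≡Σcp i ⟩
    Σℚ (λ l → c l * ℕ→ℚ (p l i))     ≡⟨ Σℚ-cong (λ l → weighted≡ l i) ⟩
    Σℚ (λ l → c l * ℕ→ℚ (u i))       ≡⟨ Σℚ-*ʳ (ℕ→ℚ (u i)) c ⟩
    Σℚ c * ℕ→ℚ (u i)                 ≡⟨ cong (_* ℕ→ℚ (u i)) Σc≡1 ⟩
    1ℚ * ℕ→ℚ (u i)                   ≡⟨ ℚP.*-identityˡ _ ⟩
    ℕ→ℚ (u i)                        ∎
    where
    weighted-terms≡0 : ∀ i → i ∈ σ → ∀ l → c l * ℕ→ℚ (p l i) ≡ 0ℚ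
    weighted-terms≡0 i i∈σ = Σℚ-nonNeg≡0⇒≡0 (λ l → c l * ℕ→ℚ (p l i))
      (λ l → nonNeg*nonNeg (0≤c l) (ℕ→ℚ-nonNeg (p l i))) (trans (sym (x≡Σcp i)) (x|σ≡0 i i∈σ))
    weighted≡ : ∀ l i → c l * ℕ→ℚ (p l i) ≡ c l * ℕ→ℚ (u i)
    weighted≡ l i with c l ℚP.≟ 0ℚ
    ... | yes cₗ≡0 rewrite cₗ≡0 = trans (ℚP.*-zeroˡ (ℕ→ℚ (p l i))) (sym (ℚP.*-zeroˡ (ℕ→ℚ (u i))))
    ... | no  cₗ≢0 = cong (λ k → c l * ℕ→ℚ k) (fibre-agreeing-on-basis⇒≡ (p∈fiber l) pₗ|σ≡u i)
      where
      pₗ|σ≡u : ∀ i → i ∈ σ → p l i ≡ u i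
      pₗ|σ≡u i i∈σ = trans (ℕ→ℚ-injective {b = 0} (≢0∧*≡0⇒≡0 cₗ≢0 (weighted-terms≡0 i i∈σ l))) (sym (u|σ≡0 i i∈σ))

  vanishing-on-basis⇒vertex : ∀ {u} → (∀ i → i ∈ σ → u i ≡ 0) → IsVertex B u u
  vanishing-on-basis⇒vertex {u} u|σ≡0 = InP-point B u (InFiber-refl B u) , extremal
    where
    extremal : (p q : Fin n → ℚ) (t : ℚ) → InP B u p → InP B u q → 0ℚ < t → t < 1ℚ →
               (∀ i → ℕ→ℚ (u i) ≡ t * p i + (1ℚ - t) * q i) → ∀ i → p i ≡ q i
    extremal p q t p∈P q∈P 0<t t<1 u≡tp+[1-t]q i =
      trans (InP-vanishing-on-basis⇒≡u u|σ≡0 p∈P p|σ≡0 i) (sym (InP-vanishing-on-basis⇒≡u u|σ≡0 q∈P q|σ≡0 i))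
      where
      0<1-t : 0ℚ < 1ℚ - t
      0<1-t = ℚP.≤-<-trans (ℚP.≤-reflexive (sym (ℚP.+-inverseʳ t))) (ℚP.+-monoˡ-< (- t) t<1)
      0≤tp : ∀ i → 0ℚ ≤ t * p i
      0≤tp i = nonNeg*nonNeg (ℚP.<⇒≤ 0<t) (InP-nonNeg B p∈P i)
      0≤[1-t]q : ∀ i → 0ℚ ≤ (1ℚ - t) * q i
      0≤[1-t]q i = nonNeg*nonNeg (ℚP.<⇒≤ 0<1-t) (InP-nonNeg B q∈P i)
      tp+[1-t]q≡0 : ∀ i → i ∈ σ → t * p i + (1ℚ - t) * q i ≡ 0ℚ
      tp+[1-t]q≡0 i i∈σ = trans (sym (u≡tp+[1-t]q i)) (cong ℕ→ℚ (u|σ≡0 i i∈σ))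
      p|σ≡0 : ∀ i → i ∈ σ → p i ≡ 0ℚ
      p|σ≡0 i i∈σ = ≢0∧*≡0⇒≡0 (ℚP.<⇒≢ 0<t ∘ sym)
        (nonNeg+nonNeg≡0⇒≡0 (0≤tp i) (0≤[1-t]q i) (tp+[1-t]q≡0 i i∈σ))
      q|σ≡0 : ∀ i → i ∈ σ → q i ≡ 0ℚ
      q|σ≡0 i i∈σ = ≢0∧*≡0⇒≡0 (ℚP.<⇒≢ 0<1-t ∘ sym)
        (nonNeg+nonNeg≡0⇒≡0 (0≤[1-t]q i) (0≤tp i) (trans (ℚP.+-comm ((1ℚ - t) * q i) (t * p i)) (tp+[1-t]q≡0 i i∈σ)))

≤ₑ-scaled⇒supp⊆ : ∀ {n} {v w : Exp n} k → v ≤ₑ (k ·ₑ w) → supp v ⊆ supp w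
≤ₑ-scaled⇒supp⊆ {v = v} {w} k v≤kw {i} i∈supp-v = 1≤⇒∈supp w (1≤w (ℕP.≤-trans (∈supp⇒1≤ v i∈supp-v) (v≤kw i)))
  where
  1≤w : 1 ℕ.≤ k ℕ.* w i → 1 ℕ.≤ w i
  1≤w 1≤kw with w i
  ... | zero  = contradiction (subst (1 ℕ.≤_) (ℕP.*-zeroʳ k) 1≤kw) λ ()
  ... | suc _ = s≤s z≤n

InRadV⇒InSR : ∀ {n m} (B : Mat n m) (w : Exp n) → InRadV B w → InSR B w
InRadV⇒InSR B w (k , _ , v , v≤kw , v-not-vertex) = supp v , ≤ₑ-scaled⇒supp⊆ k v≤kw , supp-v-dependent
  where
  supp-v-dependent : ¬ Independent B (supp v)
  supp-v-dependent (σ , ∣σ∣≡m , σ-indep , supp-v⊆∁σ) = v-not-vertex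
    (vanishing-on-basis⇒vertex B ∣σ∣≡m σ-indep λ i i∈σ →
      ∉supp⇒≡0 v (λ i∈supp-v → SubsetP.x∈∁p⇒x∉p (supp-v⊆∁σ i∈supp-v) i∈σ))

-- Dependent supports give non-vertices

-- x + a, as a natural number when ∣ a ∣ ≤ x
shift : ℕ → ℤ → ℕ
shift x a = ℤ.∣ ℤ.+ x ℤ.+ a ∣

+shift : ∀ {x} a → ℤ.∣ a ∣ ℕ.≤ x → ℤ.+ shift x a ≡ ℤ.+ x ℤ.+ a
+shift (ℤ.+ a)  _   = refl
+shift -[1+ a ] a<x = trans (cong (ℤ.+_ ∘ ℤ.∣_∣) (ℤP.⊖-≥ a<x)) (sym (ℤP.⊖-≥ a<x))

x-shift : ∀ {x} a → ℤ.∣ a ∣ ℕ.≤ x → ℤ.+ x ℤ.- ℤ.+ shift x a ≡ ℤ.- a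
x-shift {x} a ∣a∣≤x = trans (cong (λ k → ℤ.+ x ℤ.- k) (+shift a ∣a∣≤x))
  (ℤ-Solver.solve 2 (λ x a → x ℤ-Solver.:- (x ℤ-Solver.:+ a) ℤ-Solver.:= ℤ-Solver.:- a) refl (ℤ.+ x) a)

shift+shift-neg : ∀ {x} a → ℤ.∣ a ∣ ℕ.≤ x → shift x a ℕ.+ shift x (ℤ.- a) ≡ x ℕ.+ x
shift+shift-neg {x} a ∣a∣≤x = ℤP.+-injective (begin
  ℤ.+ (shift x a ℕ.+ shift x (ℤ.- a))               ≡⟨ ℤP.pos-+ (shift x a) (shift x (ℤ.- a)) ⟩
  ℤ.+ shift x a ℤ.+ ℤ.+ shift x (ℤ.- a)             ≡⟨ cong₂ ℤ._+_ (+shift a ∣a∣≤x) (+shift (ℤ.- a) ∣-a∣≤x) ⟩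
  (ℤ.+ x ℤ.+ a) ℤ.+ (ℤ.+ x ℤ.+ ℤ.- a)               ≡⟨ ℤ-Solver.solve 2 (λ x a →
                                                         (x ℤ-Solver.:+ a) ℤ-Solver.:+ (x ℤ-Solver.:+ ℤ-Solver.:- a)
                                                         ℤ-Solver.:= x ℤ-Solver.:+ x) refl (ℤ.+ x) a ⟩
  ℤ.+ x ℤ.+ ℤ.+ x                                   ≡⟨ ℤP.pos-+ x x ⟨
  ℤ.+ (x ℕ.+ x)                                     ∎)
  where
  ∣-a∣≤x : ℤ.∣ ℤ.- a ∣ ℕ.≤ x
  ∣-a∣≤x = subst (ℕ._≤ x) (sym (ℤP.∣-i∣≡∣i∣ a)) ∣a∣≤x

i≡-i⇒i≡0 : ∀ {i} → i ≡ ℤ.- i → i ≡ 0ℤ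
i≡-i⇒i≡0 {ℤ.+ zero}   _  = refl
i≡-i⇒i≡0 {ℤ.+ suc n}  ()
i≡-i⇒i≡0 { -[1+ n ]} ()

midpoint : ∀ x a c → a + c ≡ x + x → x ≡ ½ * a + (1ℚ - ½) * c
midpoint x a c a+c≡2x = begin
  x                       ≡⟨ solve 1 (λ x → x := con ½ :* (x :+ x)) refl x ⟩
  ½ * (x + x)             ≡⟨ cong (½ *_) a+c≡2x ⟨
  ½ * (a + c)             ≡⟨ solve 2 (λ a c → con ½ :* (a :+ c) := con ½ :* a :+ (con 1ℚ :- con ½) :* c)
                                     refl a c ⟩
  ½ * a + (1ℚ - ½) * c    ∎

module _ {n m} (B : Mat n m) {v : Exp n} {ℓ : Fin n → ℤ}
         (ℓ∈L : InLattice B ℓ) (ℓ≢0 : ¬ (∀ i → ℓ i ≡ 0ℤ)) (∣ℓ∣≤v : ∀ i → ℤ.∣ ℓ i ∣ ℕ.≤ v i) where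

  lattice-vector⇒¬vertex : ¬ IsVertex B v v
  lattice-vector⇒¬vertex (_ , extremal) = ℓ≢0 λ i → i≡-i⇒i≡0 (begin
    ℓ i                          ≡⟨ ℤP.neg-involutive (ℓ i) ⟨
    ℤ.- (ℤ.- ℓ i)                ≡⟨ x-shift (ℤ.- ℓ i) ∣-ℓ∣≤v ⟨
    ℤ.+ v i ℤ.- ℤ.+ p⁻ i         ≡⟨ cong (λ k → ℤ.+ v i ℤ.- ℤ.+ k) (p⁺≡p⁻ i) ⟨
    ℤ.+ v i ℤ.- ℤ.+ p⁺ i         ≡⟨ x-shift (ℓ i) (∣ℓ∣≤v i) ⟩
    ℤ.- ℓ i                      ∎)
    where
    ∣-ℓ∣≤v : ∀ {i} → ℤ.∣ ℤ.- ℓ i ∣ ℕ.≤ v i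
    ∣-ℓ∣≤v {i} = subst (ℕ._≤ v i) (sym (ℤP.∣-i∣≡∣i∣ (ℓ i))) (∣ℓ∣≤v i)
    p⁺ p⁻ : Exp n
    p⁺ i = shift (v i) (ℓ i)
    p⁻ i = shift (v i) (ℤ.- ℓ i)
    p⁺∈fiber : InFiber B v p⁺
    p⁺∈fiber = InLattice-cong B (InLattice-neg B ℓ∈L) (λ i → sym (x-shift (ℓ i) (∣ℓ∣≤v i)))
    p⁻∈fiber : InFiber B v p⁻
    p⁻∈fiber = InLattice-cong B ℓ∈L (λ i → sym (trans (x-shift (ℤ.- ℓ i) ∣-ℓ∣≤v) (ℤP.neg-involutive (ℓ i))))
    v≡midpoint : ∀ i → ℕ→ℚ (v i) ≡ ½ * ℕ→ℚ (p⁺ i) + (1ℚ - ½) * ℕ→ℚ (p⁻ i)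
    v≡midpoint i = midpoint (ℕ→ℚ (v i)) (ℕ→ℚ (p⁺ i)) (ℕ→ℚ (p⁻ i)) (begin
      ℕ→ℚ (p⁺ i) + ℕ→ℚ (p⁻ i)   ≡⟨ ℕ→ℚ-+ (p⁺ i) (p⁻ i) ⟨
      ℕ→ℚ (p⁺ i ℕ.+ p⁻ i)        ≡⟨ cong ℕ→ℚ (shift+shift-neg (ℓ i) (∣ℓ∣≤v i)) ⟩
      ℕ→ℚ (v i ℕ.+ v i)          ≡⟨ ℕ→ℚ-+ (v i) (v i) ⟩
      ℕ→ℚ (v i) + ℕ→ℚ (v i)     ∎)
    p⁺≡p⁻ : ∀ i → p⁺ i ≡ p⁻ i
    p⁺≡p⁻ i = ℕ→ℚ-injective (extremal (ℕ→ℚ ∘ p⁺) (ℕ→ℚ ∘ p⁻) ½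
      (InP-point B p⁺ p⁺∈fiber) (InP-point B p⁻ p⁻∈fiber)
      (ℚP.positive⁻¹ ½) (toWitness {a? = ½ ℚP.<? 1ℚ} _) v≡midpoint i)

nonface⇒lattice-vector : ∀ {n m} (B : Mat n m) {F} → ColsIndep B → ¬ Independent B F →
  ∃ λ ℓ → InLattice B ℓ × ¬ (∀ i → ℓ i ≡ 0ℤ) × (∀ i → i ∉ F → ℓ i ≡ 0ℤ)
nonface⇒lattice-vector {n} {m} B {F} cols-indep F-dependent with kernel-or-basis m (rowsℚ B) (∁ F)
... | inj₂ (σ , ∣σ∣≡m , σ⊆∁F , σ-indep) = ⊥-elim (F-dependent (σ , ∣σ∣≡m , σ-indep , F⊆∁σ))
  where
  F⊆∁σ : F ⊆ ∁ σ
  F⊆∁σ i∈F = SubsetP.x∉p⇒x∈∁p (λ i∈σ → SubsetP.x∈∁p⇒x∉p (σ⊆∁F i∈σ) i∈F)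
... | inj₁ (z , (j₀ , zⱼ₀≢0) , z⊥∁F) with clear-denominators z
...   | d , y , y≡dz = ℓ , (y , λ _ → refl) , ℓ≢0 , ℓ|∁F≡0
  where
  ℓ : Fin n → ℤ
  ℓ i = Σℤ (λ j → B i j ℤ.* y j)
  ℤ→ℚ-ℓ : ∀ i → ℤ→ℚ (ℓ i) ≡ ℕ→ℚ (suc d) * (rowsℚ B i ∙ z)
  ℤ→ℚ-ℓ i = begin
    ℤ→ℚ (ℓ i)                                      ≡⟨ ℤ→ℚ-Bz B y i ⟩
    rowsℚ B i ∙ (ℤ→ℚ ∘ y)                          ≡⟨ Σℚ-cong (λ j → cong (rowsℚ B i j *_) (y≡dz j)) ⟩
    rowsℚ B i ∙ (λ j → ℕ→ℚ (suc d) * z j)          ≡⟨ ∙-*ʳ (rowsℚ B i) z (ℕ→ℚ (suc d)) ⟩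
    ℕ→ℚ (suc d) * (rowsℚ B i ∙ z)                  ∎
  ℓ|∁F≡0 : ∀ i → i ∉ F → ℓ i ≡ 0ℤ
  ℓ|∁F≡0 i i∉F = ℤ→ℚ-injective (trans (ℤ→ℚ-ℓ i)
    (trans (cong (ℕ→ℚ (suc d) *_) (z⊥∁F i (SubsetP.x∉p⇒x∈∁p i∉F))) (ℚP.*-zeroʳ (ℕ→ℚ (suc d)))))
  ℓ≢0 : ¬ (∀ i → ℓ i ≡ 0ℤ)
  ℓ≢0 ℓ≡0 = zⱼ₀≢0 (≢0∧*≡0⇒≡0 (ℕ→ℚ-suc≢0 d) (trans (sym (y≡dz j₀))
    (cols-indep (ℤ→ℚ ∘ y) (λ i → trans (sym (ℤ→ℚ-Bz B y i)) (cong ℤ→ℚ (ℓ≡0 i))) j₀)))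

InSR⇒InRadV : ∀ {n m} (B : Mat n m) → ColsIndep B → (w : Exp n) → InSR B w → InRadV B w
InSR⇒InRadV B cols-indep w (F , F⊆supp-w , F-dependent) with nonface⇒lattice-vector B cols-indep F-dependent
... | ℓ , ℓ∈L , ℓ≢0 , ℓ|∁F≡0 =
  k , s≤s z≤n , k ·ₑ w , (λ _ → ℕP.≤-refl) , lattice-vector⇒¬vertex B ℓ∈L ℓ≢0 ∣ℓ∣≤kw
  where
  k : ℕ
  k = suc (max 0 (List.tabulate (λ i → ℤ.∣ ℓ i ∣)))
  ∣ℓ∣≤kw : ∀ i → ℤ.∣ ℓ i ∣ ℕ.≤ k ℕ.* w i
  ∣ℓ∣≤kw i with i SubsetP.∈? F
  ... | no  i∉F rewrite ℓ|∁F≡0 i i∉F = z≤n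
  ... | yes i∈F = ℕP.≤-trans (ℕP.m≤n⇒m≤1+n (tabulate⁻ (xs≤max 0 _) i))
                             (ℕP.m≤m*n k (w i) {{ℕ.>-nonZero (∈supp⇒1≤ w (F⊆supp-w i∈F))}})

corollary2p12 : (n m : ℕ) (B : Mat n m) → ColsIndep B →
    (w : Exp n) → InSR B w ⇔ InRadV B w
corollary2p12 n m B cols-indep w = mk⇔ (InSR⇒InRadV B cols-indep w) (InRadV⇒InSR B w)
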